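{- For every $n\geq 4$, $sexy(n)=2\,twin(n)$, where $sexy(n)$ is the number of $n$-totative $t$ with $t+6$ also $n$-totative, and $twin(n)$ is the number of $n$-totative $t$ with $t+2$ also $n$-totative.
   Context: $p_i$ denotes the $i$th prime. The primorial is $\#(m)=\prod_{i=1}^{m}p_i$. The $m$-primorial set is $\{2,\ldots,\#(m)+1\}$, and an $m$-totative number is an element of it coprime to $\#(m)$. -}

module Defs where

open import Data.Nat using (ℕ; zero; suc; _+_; _*_; _≤_; _!)
open import Data.Nat.Properties using (_≤?_)
open import Data.Nat.Primality using (prime?)
open import Data.Nat.Coprimality using (Coprime; coprime?)
open import Data.List using (List; map; upTo; filter; length)
open import Data.Nat.ListAction using (product)
open import Data.Product using (_×_)
open import Data.Bool using (if_then_else_)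
open import Relation.Nullary using (does)
open import Relation.Nullary.Decidable using (Dec; _×-dec_)

findPrime : ℕ → ℕ → ℕ
findPrime zero c = c
findPrime (suc f) c = if does (prime? c) then c else findPrime f (suc c)

-- least prime > n (there is one in (n, n! + 1], so fuel n! suffices)
nextPrime : ℕ → ℕ
nextPrime n = findPrime (n !) (suc n)

-- nthPrime i = p_{i+1}  (nthPrime 0 = 2, nthPrime 1 = 3, ...)
nthPrime : ℕ → ℕ
nthPrime zero = 2
nthPrime (suc i) = nextPrime (nthPrime i)

primorial : ℕ → ℕ
primorial m = product (map nthPrime (upTo m))

Totative : ℕ → ℕ → Set
Totative m t = (2 ≤ t) × (t ≤ primorial m + 1) × Coprime t (primorial m)

totative? : ∀ m t → Dec (Totative m t)
totative? m t = (2 ≤? t) ×-dec ((t ≤? primorial m + 1) ×-dec coprime? t (primorial m))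

primorialSet : ℕ → List ℕ
primorialSet m = map (2 +_) (upTo (primorial m))

gapCount : ℕ → ℕ → ℕ
gapCount k m = length (filter (λ t → totative? m t ×-dec totative? m (t + k)) (primorialSet m))

sexy : ℕ → ℕ
sexy = gapCount 6

twin : ℕ → ℕ
twin = gapCount 2

-- Write #(n) = 6Q with Q = p₃ ⋯ pₙ coprime to 6. For k ∈ {2, 6} every s ∈ {2, …, k + 1}
-- shares a prime with #(n), so no pair (t, t + k) of totatives wraps past #(n) + 1, and
-- both counts equal the number Nₖ(N) of residues t mod N = #(n) with t and t + k units.
-- By the Chinese remainder theorem Nₖ is multiplicative in N, and multiplication by the
-- unit 3 mod Q carries gap 2 to gap 6, so N₆(Q) = N₂(Q). Modulo 6 there are two residues
-- with gap 6 (t = 1, 5) and one with gap 2 (t = 5), hence sexy = 2 N₆(Q) = 2 N₂(Q) = 2 twin.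
module Submission where

open import Defs
open import Data.Nat using (ℕ; zero; suc; _+_; _*_; _≤_; _<_; _%_; _/_; _!; NonZero; NonTrivial; z≤n; s≤s; z<s; s<s; s≤s⁻¹; n>1⇒nonTrivial; nonTrivial⇒n>1; nonTrivial⇒≢1)
open import Data.Nat.Properties
open import Data.Nat.DivMod using (m≡m%n+[m/n]*n; m%n<n; m<n⇒m%n≡m; m%n%n≡m%n; [m+kn]%n≡m%n; %-distribˡ-*)
open import Data.Nat.Divisibility
open import Data.Nat.Coprimality as Coprime using (Coprime; coprime?; coprime-divisor; coprime-Bézout; prime⇒coprime)
open import Data.Nat.GCD using (module Bézout)
open import Data.Nat.Primality using (Prime; _Rough_; prime?; prime[2]; prime⇒nonTrivial; ∤⇒rough-suc; rough∧∣⇒prime)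
open import Data.Nat.ListAction using (product)
open import Data.Nat.Tactic.RingSolver using (solve-∀)
open import Data.Bool using (true; false; if_then_else_)
open import Data.Fin using (Fin; toℕ; fromℕ<)
open import Data.Fin.Properties using (toℕ-fromℕ<; toℕ<n; toℕ-injective)
open import Data.Fin.Permutation using (Permutation; permutation)
import Algebra.Properties.Monoid.Sum as MonoidSum
import Algebra.Properties.CommutativeMonoid.Sum as CommutativeMonoidSum
open import Data.List using (map; applyUpTo; filter; length)
open import Data.List.Relation.Unary.All using (All; []; _∷_)
open import Data.List.Relation.Unary.All.Properties using (applyUpTo⁺₂; map⁺)
open import Data.Empty using (⊥-elim)
open import Data.Product using (_×_; _,_; proj₂; ∃)
open import Data.Product.Function.NonDependent.Propositional using (_×-⇔_)
open import Function using (_∘_; id; _⇔_; mk⇔; Equivalence)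
open import Relation.Binary.PropositionalEquality
open import Relation.Nullary using (Dec; does; yes; no; ¬_; contradiction)
open import Relation.Nullary.Decidable using (_×-dec_; does-⇔)
open import Relation.Unary using (Decidable)

open Equivalence using (to; from)

-- Sums over initial segments of ℕ

∑< : ℕ → (ℕ → ℕ) → ℕ
∑< zero    f = 0
∑< (suc n) f = f 0 + ∑< n (f ∘ suc)

syntax ∑< n (λ i → e) = ∑[ i < n ] e

∑-cong : ∀ n {f g : ℕ → ℕ} → (∀ i → i < n → f i ≡ g i) → ∑< n f ≡ ∑< n g
∑-cong zero    f≡g = refl
∑-cong (suc n) f≡g = cong₂ _+_ (f≡g 0 z<s) (∑-cong n (λ i i<n → f≡g (suc i) (s<s i<n)))

∑-split : ∀ m n (f : ℕ → ℕ) → ∑< (m + n) f ≡ ∑< m f + ∑[ i < n ] f (m + i)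
∑-split zero    n f = refl
∑-split (suc m) n f = trans (cong (f 0 +_) (∑-split m n (f ∘ suc))) (sym (+-assoc (f 0) _ _))

∑-last : ∀ n (f : ℕ → ℕ) → ∑< (suc n) f ≡ ∑< n f + f n
∑-last zero    f = +-identityʳ (f 0)
∑-last (suc n) f = trans (cong (f 0 +_) (∑-last n (f ∘ suc))) (sym (+-assoc (f 0) _ _))

∑-distrib-+ : ∀ n (f g : ℕ → ℕ) → ∑[ i < n ] (f i + g i) ≡ ∑< n f + ∑< n g
∑-distrib-+ zero    f g = refl
∑-distrib-+ (suc n) f g =
  trans (cong (f 0 + g 0 +_) (∑-distrib-+ n (f ∘ suc) (g ∘ suc))) (interchange (f 0) (g 0) _ _)
  where
  interchange : ∀ a b c d → a + b + (c + d) ≡ a + c + (b + d)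
  interchange = solve-∀

*-distribˡ-∑ : ∀ n c (f : ℕ → ℕ) → ∑[ i < n ] (c * f i) ≡ c * ∑< n f
*-distribˡ-∑ zero    c f = sym (*-zeroʳ c)
*-distribˡ-∑ (suc n) c f =
  trans (cong (c * f 0 +_) (*-distribˡ-∑ n c (f ∘ suc))) (sym (*-distribˡ-+ c (f 0) _))

*-distribʳ-∑ : ∀ n c (f : ℕ → ℕ) → ∑[ i < n ] (f i * c) ≡ ∑< n f * c
*-distribʳ-∑ n c f =
  trans (∑-cong n (λ i _ → *-comm (f i) c)) (trans (*-distribˡ-∑ n c f) (*-comm c _))

∑-comm : ∀ m n (f : ℕ → ℕ → ℕ) → ∑[ i < m ] ∑[ j < n ] f i j ≡ ∑[ j < n ] ∑[ i < m ] f i j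
∑-comm zero    n f = sym (∑-zero n)
  where
  ∑-zero : ∀ n → ∑[ j < n ] 0 ≡ 0
  ∑-zero zero    = refl
  ∑-zero (suc n) = ∑-zero n
∑-comm (suc m) n f = trans (cong (∑[ j < n ] f 0 j +_) (∑-comm m n (f ∘ suc)))
                           (sym (∑-distrib-+ n (f 0) (λ j → ∑[ i < m ] f (suc i) j)))

∑-blocks : ∀ q m (f : ℕ → ℕ) → ∑< (q * m) f ≡ ∑[ j < q ] ∑[ r < m ] f (j * m + r)
∑-blocks zero    m f = refl
∑-blocks (suc q) m f = trans (∑-split m (q * m) f) (cong (∑< m f +_) (trans
  (∑-blocks q m (λ i → f (m + i)))
  (∑-cong q (λ j _ → ∑-cong m (λ r _ → cong f (sym (+-assoc m (j * m) r)))))))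

∑-permute : ∀ n (σ τ : ℕ → ℕ) →
  (∀ i → i < n → σ i < n) → (∀ i → i < n → τ i < n) →
  (∀ i → i < n → τ (σ i) ≡ i) → (∀ i → i < n → σ (τ i) ≡ i) →
  ∀ f → ∑[ i < n ] f (σ i) ≡ ∑< n f
∑-permute n σ τ σ<n τ<n τσ≡id στ≡id f = begin
  ∑[ i < n ] f (σ i)             ≡⟨ ∑<≡sum n (f ∘ σ) ⟩
  sum {n} (λ i → f (σ (toℕ i)))  ≡⟨ sum-cong-≗ {n} (λ i → cong f (sym (toℕ-fromℕ< _))) ⟩
  sum {n} (λ i → f (toℕ (σ′ i))) ≡⟨ sum-permute (f ∘ toℕ) π ⟨
  sum {n} (λ i → f (toℕ i))      ≡⟨ ∑<≡sum n f ⟨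
  ∑< n f                         ∎
  where
  open ≡-Reasoning
  open MonoidSum +-0-monoid using (sum; sum-cong-≗)
  open CommutativeMonoidSum +-0-commutativeMonoid using (sum-permute)

  ∑<≡sum : ∀ n f → ∑< n f ≡ sum {n} (f ∘ toℕ)
  ∑<≡sum zero    f = refl
  ∑<≡sum (suc n) f = cong (f 0 +_) (∑<≡sum n (f ∘ suc))

  σ′ τ′ : Fin n → Fin n
  σ′ i = fromℕ< (σ<n (toℕ i) (toℕ<n i))
  τ′ i = fromℕ< (τ<n (toℕ i) (toℕ<n i))

  σ′τ′≡id : ∀ i → σ′ (τ′ i) ≡ i
  σ′τ′≡id i = toℕ-injective (trans (toℕ-fromℕ< _)
    (trans (cong σ (toℕ-fromℕ< _)) (στ≡id (toℕ i) (toℕ<n i))))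

  τ′σ′≡id : ∀ i → τ′ (σ′ i) ≡ i
  τ′σ′≡id i = toℕ-injective (trans (toℕ-fromℕ< _)
    (trans (cong τ (toℕ-fromℕ< _)) (τσ≡id (toℕ i) (toℕ<n i))))

  π : Permutation n n
  π = permutation σ′ τ′ σ′τ′≡id τ′σ′≡id

𝟙 : {A : Set} → Dec A → ℕ
𝟙 a? = if does a? then 1 else 0

𝟙-cong : {A B : Set} → A ⇔ B → (a? : Dec A) (b? : Dec B) → 𝟙 a? ≡ 𝟙 b?
𝟙-cong A⇔B a? b? = cong (λ b → if b then 1 else 0) (does-⇔ A⇔B a? b?)

𝟙-× : {A B : Set} (a? : Dec A) (b? : Dec B) → 𝟙 (a? ×-dec b?) ≡ 𝟙 a? * 𝟙 b?
𝟙-× a? b? with does a? | does b?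
... | true  | true  = refl
... | true  | false = refl
... | false | _     = refl

length-filter-map-applyUpTo : ∀ {P : ℕ → Set} (P? : Decidable P) (g f : ℕ → ℕ) n →
  length (filter P? (map g (applyUpTo f n))) ≡ ∑[ i < n ] 𝟙 (P? (g (f i)))
length-filter-map-applyUpTo P? g f zero = refl
length-filter-map-applyUpTo P? g f (suc n) with does (P? (g (f 0)))
... | true  = cong suc (length-filter-map-applyUpTo P? g (f ∘ suc) n)
... | false = length-filter-map-applyUpTo P? g (f ∘ suc) n

-- Sums of periodic functions over a full period

Periodic : ℕ → (ℕ → ℕ) → Set
Periodic n f = ∀ x → f (x + n) ≡ f x

periodic-shift : ∀ {n f} → Periodic n f → ∀ a → Periodic n (λ x → f (x + a))
periodic-shift {n} {f} per a x = trans (cong f (regroup x n a)) (per (x + a))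
  where
  regroup : ∀ x n a → x + n + a ≡ x + a + n
  regroup = solve-∀

periodic-+* : ∀ {n f} → Periodic n f → ∀ x k → f (x + k * n) ≡ f x
periodic-+* {n} {f} per x zero    = cong f (+-identityʳ x)
periodic-+* {n} {f} per x (suc k) =
  trans (cong f (regroup x n (k * n))) (trans (per (x + k * n)) (periodic-+* per x k))
  where
  regroup : ∀ x n y → x + (n + y) ≡ x + y + n
  regroup = solve-∀

periodic-% : ∀ {n f} .{{_ : NonZero n}} → Periodic n f → ∀ x → f (x % n) ≡ f x
periodic-% {n} {f} per x =
  sym (trans (cong f (m≡m%n+[m/n]*n x n)) (periodic-+* per (x % n) (x / n)))

∑-rotate : ∀ n (f : ℕ → ℕ) → Periodic n f → ∑[ j < n ] f (suc j) ≡ ∑< n f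
∑-rotate n f per = +-cancelˡ-≡ (f 0) _ _ (begin
  f 0 + ∑[ j < n ] f (suc j)  ≡⟨ ∑-last n f ⟩
  ∑< n f + f n                ≡⟨ cong (∑< n f +_) (per 0) ⟩
  ∑< n f + f 0                ≡⟨ +-comm (∑< n f) (f 0) ⟩
  f 0 + ∑< n f                ∎)
  where open ≡-Reasoning

∑-shift : ∀ n (f : ℕ → ℕ) → Periodic n f → ∀ a → ∑[ j < n ] f (j + a) ≡ ∑< n f
∑-shift n f per zero    = ∑-cong n (λ j _ → cong f (+-identityʳ j))
∑-shift n f per (suc a) = begin
  ∑[ j < n ] f (j + suc a)  ≡⟨ ∑-cong n (λ j _ → cong f (+-suc j a)) ⟩
  ∑[ j < n ] f (suc j + a)  ≡⟨ ∑-rotate n (λ x → f (x + a)) (periodic-shift per a) ⟩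
  ∑[ j < n ] f (j + a)      ≡⟨ ∑-shift n f per a ⟩
  ∑< n f                    ∎
  where open ≡-Reasoning

[m%d*n]%d≡[m*n]%d : ∀ m n d .{{_ : NonZero d}} → (m % d * n) % d ≡ (m * n) % d
[m%d*n]%d≡[m*n]%d m n d = begin
  (m % d * n) % d            ≡⟨ %-distribˡ-* (m % d) n d ⟩
  (m % d % d * (n % d)) % d  ≡⟨ cong (λ x → (x * (n % d)) % d) (m%n%n≡m%n m d) ⟩
  (m % d * (n % d)) % d      ≡⟨ %-distribˡ-* m n d ⟨
  (m * n) % d                ∎
  where open ≡-Reasoning

%-inverse : ∀ {b n} .{{_ : NonZero n}} → Coprime b n → ∃ λ b′ → (b * b′) % n ≡ 1 % n
%-inverse {b} {suc n′} b⊥n with coprime-Bézout b⊥n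
... | Bézout.+- x y 1+yn≡xb = x , (begin
  (b * x) % suc n′           ≡⟨ cong (_% suc n′) (trans (*-comm b x) (sym 1+yn≡xb)) ⟩
  (1 + y * suc n′) % suc n′  ≡⟨ [m+kn]%n≡m%n 1 y (suc n′) ⟩
  1 % suc n′                 ∎)
  where open ≡-Reasoning
-- 1 + x b ≡ 0 and n′ ≡ -1 (mod n), so x n′ inverts b.
... | Bézout.-+ x y 1+xb≡yn = x * n′ , (begin
  (b * (x * n′)) % suc n′                       ≡⟨ [m+kn]%n≡m%n (b * (x * n′)) y (suc n′) ⟨
  (b * (x * n′) + y * suc n′) % suc n′          ≡⟨ cong (λ z → (b * (x * n′) + z) % suc n′) (sym 1+xb≡yn) ⟩
  (b * (x * n′) + (1 + x * b)) % suc n′         ≡⟨ cong (_% suc n′) (regroup b x n′) ⟩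
  (1 + x * b * suc n′) % suc n′                 ≡⟨ [m+kn]%n≡m%n 1 (x * b) (suc n′) ⟩
  1 % suc n′                                    ∎)
  where
  open ≡-Reasoning
  regroup : ∀ b x n′ → b * (x * n′) + (1 + x * b) ≡ 1 + x * b * suc n′
  regroup = solve-∀

%-inverse-cancel : ∀ {b b′ n} .{{_ : NonZero n}} → (b * b′) % n ≡ 1 % n →
  ∀ y → y < n → ((y * b) % n * b′) % n ≡ y
%-inverse-cancel {b} {b′} {n} bb′≡1 y y<n = begin
  ((y * b) % n * b′) % n  ≡⟨ [m%d*n]%d≡[m*n]%d (y * b) b′ n ⟩
  (y * b * b′) % n        ≡⟨ cong (_% n) (trans (*-assoc y b b′) (*-comm y (b * b′))) ⟩
  (b * b′ * y) % n        ≡⟨ [m%d*n]%d≡[m*n]%d (b * b′) y n ⟨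
  ((b * b′) % n * y) % n  ≡⟨ cong (λ z → (z * y) % n) bb′≡1 ⟩
  (1 % n * y) % n         ≡⟨ [m%d*n]%d≡[m*n]%d 1 y n ⟩
  (1 * y) % n             ≡⟨ cong (_% n) (*-identityˡ y) ⟩
  y % n                   ≡⟨ m<n⇒m%n≡m y<n ⟩
  y                       ∎
  where open ≡-Reasoning

∑-scale : ∀ n .{{_ : NonZero n}} (f : ℕ → ℕ) → Periodic n f →
  ∀ {b} → Coprime b n → ∑[ j < n ] f (j * b) ≡ ∑< n f
∑-scale n f per {b} b⊥n with %-inverse b⊥n
... | b′ , bb′≡1 = trans (∑-cong n (λ j _ → sym (periodic-% per (j * b))))
  (∑-permute n σ τ (λ i _ → m%n<n (i * b) n) (λ i _ → m%n<n (i * b′) n)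
     (%-inverse-cancel bb′≡1) (%-inverse-cancel (trans (cong (_% n) (*-comm b′ b)) bb′≡1)) f)
  where
  σ τ : ℕ → ℕ
  σ j = (j * b) % n
  τ y = (y * b′) % n

∑-affine : ∀ n .{{_ : NonZero n}} (f : ℕ → ℕ) → Periodic n f →
  ∀ {b} → Coprime b n → ∀ a → ∑[ j < n ] f (j * b + a) ≡ ∑< n f
∑-affine n f per b⊥n a =
  trans (∑-scale n (λ x → f (x + a)) (periodic-shift per a) b⊥n) (∑-shift n f per a)

coprime-*ˡ : ∀ {a b n} → Coprime a n → Coprime b n → Coprime (a * b) n
coprime-*ˡ {a} a⊥n b⊥n {d} (d∣ab , d∣n) = b⊥n (coprime-divisor d⊥a d∣ab , d∣n)
  where
  d⊥a : Coprime d a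
  d⊥a (e∣d , e∣a) = a⊥n (e∣a , ∣-trans e∣d d∣n)

coprime-*ʳ⇔ : ∀ {a m n} → Coprime a (m * n) ⇔ (Coprime a m × Coprime a n)
coprime-*ʳ⇔ {a} {m} {n} = mk⇔ split combine
  where
  split : Coprime a (m * n) → Coprime a m × Coprime a n
  split a⊥mn = (λ (d∣a , d∣m) → a⊥mn (d∣a , ∣-trans d∣m (m∣m*n n)))
             , (λ (d∣a , d∣n) → a⊥mn (d∣a , ∣-trans d∣n (n∣m*n m)))
  combine : Coprime a m × Coprime a n → Coprime a (m * n)
  combine (a⊥m , a⊥n) = Coprime.sym (coprime-*ˡ (Coprime.sym a⊥m) (Coprime.sym a⊥n))

coprime-*unit⇔ : ∀ {a b n} → Coprime b n → Coprime (a * b) n ⇔ Coprime a n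
coprime-*unit⇔ {a} {b} {n} b⊥n = mk⇔ cancel (λ a⊥n → coprime-*ˡ a⊥n b⊥n)
  where
  cancel : Coprime (a * b) n → Coprime a n
  cancel ab⊥n (d∣a , d∣n) = ab⊥n (∣-trans d∣a (m∣m*n b) , d∣n)

coprime-∣+⇔ : ∀ {x y n} → n ∣ y → Coprime (y + x) n ⇔ Coprime x n
coprime-∣+⇔ {x} {y} {n} n∣y = mk⇔ drop add
  where
  drop : Coprime (y + x) n → Coprime x n
  drop y+x⊥n (d∣x , d∣n) = y+x⊥n (∣m∣n⇒∣m+n (∣-trans d∣n n∣y) d∣x , d∣n)
  add : Coprime x n → Coprime (y + x) n
  add x⊥n (d∣y+x , d∣n) = x⊥n (∣m+n∣m⇒∣n d∣y+x (∣-trans d∣n n∣y) , d∣n)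

product-coprime : ∀ {as n} → All (λ a → Coprime a n) as → Coprime (product as) n
product-coprime []         (d∣1 , _) = ∣1⇒≡1 d∣1
product-coprime (a⊥n ∷ as) = coprime-*ˡ a⊥n (product-coprime as)

-- Residues t mod N with t and t + k both units: Nₖ(N) = cyclicGapCount k N

CoprimePair : ℕ → ℕ → ℕ → Set
CoprimePair k N t = Coprime t N × Coprime (t + k) N

coprimePair? : ∀ k N → Decidable (CoprimePair k N)
coprimePair? k N t = coprime? t N ×-dec coprime? (t + k) N

cyclicGapCount : ℕ → ℕ → ℕ
cyclicGapCount k N = ∑[ t < N ] 𝟙 (coprimePair? k N t)

coprimePair-∣+⇔ : ∀ {k N x y} → N ∣ y → CoprimePair k N (y + x) ⇔ CoprimePair k N x
coprimePair-∣+⇔ {k} {N} {x} {y} N∣y = coprime-∣+⇔ N∣y ×-⇔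
  subst (λ z → Coprime z N ⇔ Coprime (x + k) N) (sym (+-assoc y x k)) (coprime-∣+⇔ N∣y)

coprimePair-*⇔ : ∀ {k m n t} → CoprimePair k (m * n) t ⇔ (CoprimePair k m t × CoprimePair k n t)
coprimePair-*⇔ {k} {m} {n} {t} = mk⇔ split join
  where
  split : CoprimePair k (m * n) t → CoprimePair k m t × CoprimePair k n t
  split (t⊥mn , t+k⊥mn) with to coprime-*ʳ⇔ t⊥mn | to coprime-*ʳ⇔ t+k⊥mn
  ... | t⊥m , t⊥n | t+k⊥m , t+k⊥n = (t⊥m , t+k⊥m) , (t⊥n , t+k⊥n)
  join : CoprimePair k m t × CoprimePair k n t → CoprimePair k (m * n) t
  join ((t⊥m , t+k⊥m) , (t⊥n , t+k⊥n)) = from coprime-*ʳ⇔ (t⊥m , t⊥n) , from coprime-*ʳ⇔ (t+k⊥m , t+k⊥n)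

coprimePair-periodic : ∀ k N → Periodic N (λ t → 𝟙 (coprimePair? k N t))
coprimePair-periodic k N t = trans (cong (λ x → 𝟙 (coprimePair? k N x)) (+-comm t N))
  (𝟙-cong (coprimePair-∣+⇔ ∣-refl) (coprimePair? k N (N + t)) (coprimePair? k N t))

cyclicGapCount-* : ∀ k {M Q} → Coprime M Q →
  cyclicGapCount k (Q * M) ≡ cyclicGapCount k Q * cyclicGapCount k M
cyclicGapCount-* k {M} {zero}      M⊥Q = refl
cyclicGapCount-* k {M} {Q@(suc _)} M⊥Q = begin
  ∑[ t < Q * M ] χ (Q * M) t
    ≡⟨ ∑-blocks Q M (χ (Q * M)) ⟩
  ∑[ j < Q ] ∑[ r < M ] χ (Q * M) (j * M + r)
    ≡⟨ ∑-cong Q (λ j _ → ∑-cong M (λ r _ → crt j r)) ⟩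
  ∑[ j < Q ] ∑[ r < M ] (χ Q (j * M + r) * χ M r)
    ≡⟨ ∑-comm Q M (λ j r → χ Q (j * M + r) * χ M r) ⟩
  ∑[ r < M ] ∑[ j < Q ] (χ Q (j * M + r) * χ M r)
    ≡⟨ ∑-cong M (λ r _ → *-distribʳ-∑ Q (χ M r) (λ j → χ Q (j * M + r))) ⟩
  ∑[ r < M ] (∑[ j < Q ] χ Q (j * M + r) * χ M r)
    ≡⟨ ∑-cong M (λ r _ → cong (_* χ M r) (∑-affine Q (χ Q) (coprimePair-periodic k Q) M⊥Q r)) ⟩
  ∑[ r < M ] (cyclicGapCount k Q * χ M r)
    ≡⟨ *-distribˡ-∑ M (cyclicGapCount k Q) (χ M) ⟩
  cyclicGapCount k Q * cyclicGapCount k M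
    ∎
  where
  open ≡-Reasoning
  χ : ℕ → ℕ → ℕ
  χ N t = 𝟙 (coprimePair? k N t)

  crt : ∀ j r → χ (Q * M) (j * M + r) ≡ χ Q (j * M + r) * χ M r
  crt j r = begin
    χ (Q * M) t      ≡⟨ 𝟙-cong coprimePair-*⇔ (coprimePair? k (Q * M) t) (Q? ×-dec M?) ⟩
    𝟙 (Q? ×-dec M?)  ≡⟨ 𝟙-× Q? M? ⟩
    χ Q t * χ M t    ≡⟨ cong (χ Q t *_) (𝟙-cong (coprimePair-∣+⇔ (n∣m*n j)) M? (coprimePair? k M r)) ⟩
    χ Q t * χ M r    ∎
    where
    t : ℕ
    t = j * M + r
    Q? : Dec (CoprimePair k Q t)
    Q? = coprimePair? k Q t
    M? : Dec (CoprimePair k M t)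
    M? = coprimePair? k M t

cyclicGapCount-scale : ∀ k {b N} → Coprime b N → cyclicGapCount (b * k) N ≡ cyclicGapCount k N
cyclicGapCount-scale k {b} {zero}      b⊥N = refl
cyclicGapCount-scale k {b} {N@(suc _)} b⊥N = begin
  ∑[ t < N ] 𝟙 (coprimePair? (b * k) N t)
    ≡⟨ ∑-scale N _ (coprimePair-periodic (b * k) N) b⊥N ⟨
  ∑[ j < N ] 𝟙 (coprimePair? (b * k) N (j * b))
    ≡⟨ ∑-cong N (λ j _ → 𝟙-cong (scaled j) (coprimePair? (b * k) N (j * b)) (coprimePair? k N j)) ⟩
  ∑[ j < N ] 𝟙 (coprimePair? k N j)
    ∎
  where
  open ≡-Reasoning
  factor : ∀ j b k → j * b + b * k ≡ (j + k) * b
  factor = solve-∀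
  scaled : ∀ j → CoprimePair (b * k) N (j * b) ⇔ CoprimePair k N j
  scaled j = coprime-*unit⇔ b⊥N ×-⇔
    subst (λ z → Coprime z N ⇔ Coprime (j + k) N) (sym (factor j b k)) (coprime-*unit⇔ b⊥N)

gapCount≡cyclicGapCount : ∀ k m → (∀ s → 2 ≤ s → s ≤ suc k → ¬ Coprime s (primorial m)) →
  gapCount k m ≡ cyclicGapCount k (primorial m)
gapCount≡cyclicGapCount k m smallShares = begin
  gapCount k m
    ≡⟨ length-filter-map-applyUpTo pair? (2 +_) id P ⟩
  ∑[ i < P ] 𝟙 (pair? (2 + i))
    ≡⟨ ∑-cong P (λ i i<P → 𝟙-cong (pair⇔ i i<P) (pair? (2 + i)) (χ (2 + i))) ⟩
  ∑[ i < P ] 𝟙 (χ (2 + i))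
    ≡⟨ ∑-cong P (λ i _ → cong (λ t → 𝟙 (χ t)) (+-comm 2 i)) ⟩
  ∑[ i < P ] 𝟙 (χ (i + 2))
    ≡⟨ ∑-shift P (𝟙 ∘ χ) (coprimePair-periodic k P) 2 ⟩
  cyclicGapCount k P
    ∎
  where
  open ≡-Reasoning
  P : ℕ
  P = primorial m

  pair? : Decidable (λ t → Totative m t × Totative m (t + k))
  pair? t = totative? m t ×-dec totative? m (t + k)

  χ : Decidable (CoprimePair k P)
  χ = coprimePair? k P

  -- u = P + s with 2 ≤ s ≤ k + 1 would make s coprime to P.
  beyond : ∀ {u} → P + 2 ≤ u → u ≤ P + suc k → ¬ Coprime u P
  beyond P+2≤u u≤P+1+k u⊥P with m≤n⇒∃[o]m+o≡n P+2≤u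
  ... | o , refl = smallShares (2 + o) (s≤s (s≤s z≤n))
    (+-cancelˡ-≤ P _ _ (subst (_≤ P + suc k) (+-assoc P 2 o) u≤P+1+k))
    (to (coprime-∣+⇔ ∣-refl) (subst (λ u → Coprime u P) (+-assoc P 2 o) u⊥P))

  noWrap : ∀ t → t ≤ P + 1 → Coprime (t + k) P → t + k ≤ P + 1
  noWrap t t≤P+1 t+k⊥P with t + k ≤? P + 1
  ... | yes fits = fits
  ... | no ¬fits = ⊥-elim (beyond
    (subst (_≤ t + k) (sym (+-suc P 1)) (≰⇒> ¬fits))
    (subst (t + k ≤_) (+-assoc P 1 k) (+-monoˡ-≤ k t≤P+1)) t+k⊥P)

  pair⇔ : ∀ i → i < P → (Totative m (2 + i) × Totative m (2 + i + k)) ⇔ CoprimePair k P (2 + i)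
  pair⇔ i i<P = mk⇔
    (λ ((_ , _ , t⊥P) , (_ , _ , t+k⊥P)) → t⊥P , t+k⊥P)
    (λ (t⊥P , t+k⊥P) → (2≤t , t≤P+1 , t⊥P)
                     , (≤-trans 2≤t (m≤m+n (2 + i) k) , noWrap (2 + i) t≤P+1 t+k⊥P , t+k⊥P))
    where
    2≤t : 2 ≤ 2 + i
    2≤t = m≤m+n 2 i
    t≤P+1 : 2 + i ≤ P + 1
    t≤P+1 = subst (2 + i ≤_) (+-comm 1 P) (s≤s i<P)

210∣⇒¬coprime : ∀ {P} → 210 ∣ P → ∀ s → 2 ≤ s → s ≤ 7 → ¬ Coprime s P
210∣⇒¬coprime 210∣P 1 (s≤s ()) _
210∣⇒¬coprime 210∣P 2 _ _ s⊥P = contradiction (s⊥P (∣-refl , ∣-trans (divides 105 refl) 210∣P)) λ ()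
210∣⇒¬coprime 210∣P 3 _ _ s⊥P = contradiction (s⊥P (∣-refl , ∣-trans (divides 70 refl) 210∣P)) λ ()
210∣⇒¬coprime 210∣P 4 _ _ s⊥P = contradiction (s⊥P {2} (divides 2 refl , ∣-trans (divides 105 refl) 210∣P)) λ ()
210∣⇒¬coprime 210∣P 5 _ _ s⊥P = contradiction (s⊥P (∣-refl , ∣-trans (divides 42 refl) 210∣P)) λ ()
210∣⇒¬coprime 210∣P 6 _ _ s⊥P = contradiction (s⊥P (∣-refl , ∣-trans (divides 35 refl) 210∣P)) λ ()
210∣⇒¬coprime 210∣P 7 _ _ s⊥P = contradiction (s⊥P (∣-refl , ∣-trans (divides 30 refl) 210∣P)) λ ()
210∣⇒¬coprime 210∣P (suc (suc (suc (suc (suc (suc (suc (suc _))))))))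
  _ (s≤s (s≤s (s≤s (s≤s (s≤s (s≤s (s≤s ())))))))

-- The search keeps the invariant that no d ∈ [2, c) divides N, so it cannot run past N.
findPrime-prime : ∀ f c N → .{{NonTrivial N}} → 2 ≤ c → c Rough N → N < c + f → Prime (findPrime f c)
findPrime-prime zero    c N 2≤c rough N<c = contradiction
  (hasNonTrivialDivisor (subst (N <_) (+-identityʳ c) N<c) ∣-refl) rough
findPrime-prime (suc f) c N 2≤c rough N<c+1+f with prime? c
... | yes c-prime = c-prime
... | no ¬c-prime = findPrime-prime f (suc c) N (m≤n⇒m≤1+n 2≤c)
  (∤⇒rough-suc (λ c∣N → ¬c-prime (rough∧∣⇒prime {{n>1⇒nonTrivial 2≤c}} rough c∣N)) rough)
  (subst (N <_) (+-suc c f) N<c+1+f)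

findPrime-≥ : ∀ f c → c ≤ findPrime f c
findPrime-≥ zero    c = ≤-refl
findPrime-≥ (suc f) c with does (prime? c)
... | true  = ≤-refl
... | false = <⇒≤ (findPrime-≥ f (suc c))

-- Euclid: k! + 1 has no divisor in [2, k], so a prime lies in (k, k! + 1].
nextPrime-prime : ∀ k → 1 ≤ k → Prime (nextPrime k)
nextPrime-prime k 1≤k = findPrime-prime (k !) (suc k) (suc (k !))
  {{n>1⇒nonTrivial (s≤s (1≤n! k))}} (s≤s 1≤k) rough (s≤s (+-monoˡ-≤ (k !) 1≤k))
  where
  rough : suc k Rough suc (k !)
  rough (hasNonTrivialDivisor {d} d<1+k d∣1+k!) = nonTrivial⇒≢1 {d} (∣1⇒≡1 (∣m+n∣m⇒∣n
    (subst (d ∣_) (+-comm 1 (k !)) d∣1+k!) (∣k! (<⇒≤ (nonTrivial⇒n>1 d)) (s≤s⁻¹ d<1+k))))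
    where
    ∣k! : ∀ {d} → 1 ≤ d → d ≤ k → d ∣ k !
    ∣k! {suc d} _ d<k = ∣-trans (m∣m*n (d !)) (m≤n⇒m!∣n! d<k)

nthPrime-< : ∀ i → nthPrime i < nthPrime (suc i)
nthPrime-< i = findPrime-≥ (nthPrime i !) (suc (nthPrime i))

nthPrime-prime : ∀ i → Prime (nthPrime i)
nthPrime-prime zero    = prime[2]
nthPrime-prime (suc i) = nextPrime-prime (nthPrime i)
  (<⇒≤ (nonTrivial⇒n>1 (nthPrime i) {{prime⇒nonTrivial (nthPrime-prime i)}}))

5≤nthPrime[2+i] : ∀ i → 5 ≤ nthPrime (2 + i)
5≤nthPrime[2+i] zero    = ≤-refl
5≤nthPrime[2+i] (suc i) = ≤-trans (5≤nthPrime[2+i] i) (<⇒≤ (nthPrime-< (2 + i)))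

-- p₃ ⋯ p_{m+2}
primorial/6 : ℕ → ℕ
primorial/6 m = product (map nthPrime (applyUpTo (2 +_) m))

primorial≡primorial/6*6 : ∀ m → primorial (2 + m) ≡ primorial/6 m * 6
primorial≡primorial/6*6 m = trans (sym (*-assoc 2 3 (primorial/6 m))) (*-comm 6 (primorial/6 m))

primorial/6-coprime-6 : ∀ m → Coprime (primorial/6 m) 6
primorial/6-coprime-6 m = product-coprime (map⁺ (applyUpTo⁺₂ (2 +_) m p⊥6))
  where
  p⊥6 : ∀ i → Coprime (nthPrime (2 + i)) 6
  p⊥6 i = from coprime-*ʳ⇔ ( prime⇒coprime (nthPrime-prime (2 + i)) (≤-trans (m≤m+n 3 2) (5≤nthPrime[2+i] i))
                           , prime⇒coprime (nthPrime-prime (2 + i)) (≤-trans (m≤m+n 4 1) (5≤nthPrime[2+i] i)))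

210∣primorial : ∀ m → 210 ∣ primorial (4 + m)
210∣primorial m = divides L (regroup L)
  where
  L : ℕ
  L = product (map nthPrime (applyUpTo (4 +_) m))
  regroup : ∀ L → 2 * (3 * (5 * (7 * L))) ≡ L * 210
  regroup = solve-∀

corollary7 : (n : ℕ) → 4 ≤ n → sexy n ≡ 2 * twin n
corollary7 .(4 + m) (s≤s (s≤s (s≤s (s≤s (z≤n {m}))))) = begin
  sexy (4 + m)                    ≡⟨ gapCount≡cyclicGapCount 6 (4 + m) (210∣⇒¬coprime (210∣primorial m)) ⟩
  cyclicGapCount 6 P              ≡⟨ cong (cyclicGapCount 6) P≡Q*6 ⟩
  cyclicGapCount 6 (Q * 6)        ≡⟨ cyclicGapCount-* 6 (Coprime.sym Q⊥6) ⟩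
  cyclicGapCount 6 Q * 2          ≡⟨ cong (_* 2) (cyclicGapCount-scale 2 3⊥Q) ⟩
  cyclicGapCount 2 Q * 2          ≡⟨ *-comm (cyclicGapCount 2 Q) 2 ⟩
  2 * cyclicGapCount 2 Q          ≡⟨ cong (2 *_) (sym (*-identityʳ (cyclicGapCount 2 Q))) ⟩
  2 * (cyclicGapCount 2 Q * 1)    ≡⟨ cong (2 *_) (cyclicGapCount-* 2 (Coprime.sym Q⊥6)) ⟨
  2 * cyclicGapCount 2 (Q * 6)    ≡⟨ cong (λ N → 2 * cyclicGapCount 2 N) P≡Q*6 ⟨
  2 * cyclicGapCount 2 P          ≡⟨ cong (2 *_) (gapCount≡cyclicGapCount 2 (4 + m) small) ⟨
  2 * twin (4 + m)                ∎
  where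
  open ≡-Reasoning
  P Q : ℕ
  P = primorial (4 + m)
  Q = primorial/6 (2 + m)
  P≡Q*6 : P ≡ Q * 6
  P≡Q*6 = primorial≡primorial/6*6 (2 + m)
  Q⊥6 : Coprime Q 6
  Q⊥6 = primorial/6-coprime-6 (2 + m)
  3⊥Q : Coprime 3 Q
  3⊥Q = Coprime.sym (proj₂ (to (coprime-*ʳ⇔ {Q} {2} {3}) Q⊥6))
  small : ∀ s → 2 ≤ s → s ≤ 3 → ¬ Coprime s P
  small s 2≤s s≤3 = 210∣⇒¬coprime (210∣primorial m) s 2≤s (≤-trans s≤3 (m≤m+n 3 4))
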